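{- Let $s^1,s^2$ be two related strings of length $n$ over a finite alphabet $\Sigma$. Let $x=(x_b)_{b\in B}$ be any feasible solution of the linear program $\mathrm{LP}_{\mathrm{cb}}$, and define $y=\pi(x)$ by $$y^1_{t,k}=\sum_{b=(t_b,k^1_b,k^2_b)\in B:\ t_b=t,\ k^1_b=k} x_b \quad (t\in T,\ k\in Q^1_t),\qquad y^2_{t,k}=\sum_{b\in B:\ t_b=t,\ k^2_b=k} x_b \quad (t\in T,\ k\in Q^2_t).$$ Then $y$ is a feasible solution of the linear program $\mathrm{LP}_{\mathrm{cs}}$. That is, the feasible region of $\mathrm{LP}_{\mathrm{cb}}$, mapped by $\pi$ into the space of $y$-variables, is contained in the feasible region of $\mathrm{LP}_{\mathrm{cs}}$.
   Context: Two strings $s^1,s^2$ over $\Sigma$ are related if every letter occurs the same number of times in each; in particular both have the same length $n$. Positions are numbered $1,\dots,n$. A common block is a triple $b=(t_b,k^1_b,k^2_b)$, where $t_b$ is a nonempty string that occurs as a substring of $s^1$ starting at position $k^1_b$ and as a substring of $s^2$ starting at position $k^2_b$. Let $B$ be the set of all common blocks. $\mathrm{LP}_{\mathrm{cb}}$ has real variables $x_b$ for $b\in B$. It minimizes $\sum_{b\in B}x_b$ subject to: - $\sum_{b\in B:\ k^1_b\le j<k^1_b+|t_b|} x_b=1$ for $j=1,\dots,n$; - $\sum_{b\in B:\ k^2_b\le j<k^2_b+|t_b|} x_b=1$ for $j=1,\dots,n$; - $0\le x_b\le 1$ for all $b\in B$. Let $T$ be the set of distinct nonempty strings that occur as substrings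 of both $s^1$ and $s^2$. For $t\in T$ and $i\in\{1,2\}$, let $Q^i_t\subseteq\{1,\dots,n\}$ be the set of starting positions of occurrences of $t$ in $s^i$. $\mathrm{LP}_{\mathrm{cs}}$ has real variables $y^1_{t,k}$ for $t\in T,\ k\in Q^1_t$, and $y^2_{t,k}$ for $t\in T,\ k\in Q^2_t$. It minimizes $\sum_{t\in T}\sum_{k\in Q^1_t}y^1_{t,k}$ subject to: - $\sum_{t\in T}\sum_{k\in Q^i_t:\ k\le j<k+|t|} y^i_{t,k}=1$ for $i=1,2$ and $j=1,\dots,n$; - $\sum_{k\in Q^1_t}y^1_{t,k}=\sum_{k\in Q^2_t}y^2_{t,k}$ for all $t\in T$; - all variables lie in $[0,1]$.
   Formalization: The variables $x_b$ of $\mathrm{LP}_{\mathrm{cb}}$ take rational values rather than real ones, so the variables of $\mathrm{LP}_{\mathrm{cs}}$ are rational as well. -}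

module Defs where

open import Data.Nat as ℕ using (ℕ; zero; suc; _∸_)
import Data.Nat.Properties as ℕP
open import Data.Fin using (Fin)
open import Data.Fin.Properties using (_≟_)
open import Data.List using (List; []; _∷_; length; take; drop; filter; map; concatMap; upTo; foldr)
open import Data.List.Properties using (≡-dec)
open import Data.List.Relation.Binary.Infix.Heterogeneous using (Infix)
open import Data.List.Relation.Binary.Infix.Heterogeneous.Properties using (infix?)
open import Data.Product using (_×_; _,_; proj₁; proj₂)
open import Data.Rational using (ℚ; 0ℚ; 1ℚ; _+_; _≤_)
open import Relation.Binary.PropositionalEquality using (_≡_; _≢_)
open import Relation.Nullary using (Dec; ¬?)
open import Relation.Nullary.Decidable using (_×-dec_)

Str : ℕ → Set
Str σ = List (Fin σ)

module _ {σ : ℕ} where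

  count : Fin σ → Str σ → ℕ
  count a s = length (filter (a ≟_) s)

  Related : Str σ → Str σ → Set
  Related s₁ s₂ = ∀ a → count a s₁ ≡ count a s₂

  _≟s_ : (u v : Str σ) → Dec (u ≡ v)
  _≟s_ = ≡-dec _≟_

  -- t occurs in s starting at (0-based) position k,
  -- i.e. at position k+1 in the paper's 1-based numbering
  OccursAt : Str σ → Str σ → ℕ → Set
  OccursAt t s k = take (length t) (drop k s) ≡ t

  occursAt? : ∀ t s k → Dec (OccursAt t s k)
  occursAt? t s k = take (length t) (drop k s) ≟s t

  Substring : Str σ → Str σ → Set
  Substring t s = Infix _≡_ t s

  qsum : List ℚ → ℚ
  qsum = foldr _+_ 0ℚ

  Block : Set
  Block = Str σ × ℕ × ℕ

  str : Block → Str σ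
  str = proj₁

  pos₁ pos₂ : Block → ℕ
  pos₁ b = proj₁ (proj₂ b)
  pos₂ b = proj₂ (proj₂ b)

  IsBlock : Str σ → Str σ → Block → Set
  IsBlock s₁ s₂ (t , k₁ , k₂) = (t ≢ []) × OccursAt t s₁ k₁ × OccursAt t s₂ k₂

  isBlock? : ∀ s₁ s₂ b → Dec (IsBlock s₁ s₂ b)
  isBlock? s₁ s₂ (t , k₁ , k₂) =
    ¬? (t ≟s []) ×-dec (occursAt? t s₁ k₁ ×-dec occursAt? t s₂ k₂)

  -- Enumeration of B, each common block exactly once: a block is
  -- determined by k¹ < |s¹|, its length ℓ ≤ |s¹| - k¹ and k² < |s²|.
  candidates : Str σ → Str σ → List Block
  candidates s₁ s₂ =
    concatMap (λ k₁ →
      concatMap (λ ℓ →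
        map (λ k₂ → (take ℓ (drop k₁ s₁) , k₁ , k₂)) (upTo (length s₂)))
        (upTo (suc (length s₁ ∸ k₁))))
      (upTo (length s₁))

  blocks : Str σ → Str σ → List Block
  blocks s₁ s₂ = filter (isBlock? s₁ s₂) (candidates s₁ s₂)

  Covers : ℕ → Str σ → ℕ → Set
  Covers k t j = (k ℕ.≤ j) × (j ℕ.< k ℕ.+ length t)

  covers? : ∀ k t j → Dec (Covers k t j)
  covers? k t j = (k ℕ.≤? j) ×-dec (j ℕ.<? k ℕ.+ length t)

  -- Feasibility for LP_cb ; x is indexed by blocks
  -- (values of x off B are irrelevant)
  FeasibleCB : Str σ → Str σ → (Block → ℚ) → Set
  FeasibleCB s₁ s₂ x =
      (∀ j → j ℕ.< length s₁ →
         qsum (map x (filter (λ b → covers? (pos₁ b) (str b) j) (blocks s₁ s₂))) ≡ 1ℚ)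
    × (∀ j → j ℕ.< length s₁ →
         qsum (map x (filter (λ b → covers? (pos₂ b) (str b) j) (blocks s₁ s₂))) ≡ 1ℚ)
    × (∀ b → IsBlock s₁ s₂ b → (0ℚ ≤ x b) × (x b ≤ 1ℚ))

  InT : Str σ → Str σ → Str σ → Set
  InT s₁ s₂ t = (t ≢ []) × Substring t s₁ × Substring t s₂

  inT? : ∀ s₁ s₂ t → Dec (InT s₁ s₂ t)
  inT? s₁ s₂ t = ¬? (t ≟s []) ×-dec (infix? _≟_ t s₁ ×-dec infix? _≟_ t s₂)

  -- Enumeration of the index set {(t , k) : t ∈ T, k ∈ Qⁱ_t} for the string
  -- s = sⁱ : each pair appears exactly once (t = s[k, k+|t|)).
  occurrences : Str σ → Str σ → Str σ → List (Str σ × ℕ)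
  occurrences s₁ s₂ s =
    filter (λ p → inT? s₁ s₂ (proj₁ p))
      (concatMap (λ k →
         map (λ ℓ → (take ℓ (drop k s) , k)) (upTo (suc (length s ∸ k))))
         (upTo (length s)))

  Q : Str σ → Str σ → List ℕ
  Q t s = filter (occursAt? t s) (upTo (length s))

  -- Feasibility for LP_cs ; y¹ y² indexed by (t , k)
  -- (values off the index sets are irrelevant)
  FeasibleCS : Str σ → Str σ → (Str σ → ℕ → ℚ) → (Str σ → ℕ → ℚ) → Set
  FeasibleCS s₁ s₂ y₁ y₂ =
      (∀ j → j ℕ.< length s₁ →
         qsum (map (λ p → y₁ (proj₁ p) (proj₂ p))
                (filter (λ p → covers? (proj₂ p) (proj₁ p) j) (occurrences s₁ s₂ s₁))) ≡ 1ℚ)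
    × (∀ j → j ℕ.< length s₁ →
         qsum (map (λ p → y₂ (proj₁ p) (proj₂ p))
                (filter (λ p → covers? (proj₂ p) (proj₁ p) j) (occurrences s₁ s₂ s₂))) ≡ 1ℚ)
    × (∀ t → InT s₁ s₂ t →
         qsum (map (y₁ t) (Q t s₁)) ≡ qsum (map (y₂ t) (Q t s₂)))
    × (∀ t → InT s₁ s₂ t → ∀ k → OccursAt t s₁ k → (0ℚ ≤ y₁ t k) × (y₁ t k ≤ 1ℚ))
    × (∀ t → InT s₁ s₂ t → ∀ k → OccursAt t s₂ k → (0ℚ ≤ y₂ t k) × (y₂ t k ≤ 1ℚ))

  π₁ : Str σ → Str σ → (Block → ℚ) → Str σ → ℕ → ℚ
  π₁ s₁ s₂ x t k =
    qsum (map x (filter (λ b → (str b ≟s t) ×-dec (pos₁ b ℕ.≟ k)) (blocks s₁ s₂)))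

  π₂ : Str σ → Str σ → (Block → ℚ) → Str σ → ℕ → ℚ
  π₂ s₁ s₂ x t k =
    qsum (map x (filter (λ b → (str b ≟s t) ×-dec (pos₂ b ℕ.≟ k)) (blocks s₁ s₂)))

{-# OPTIONS --safe #-}
-- π_i(x)_{t,k} is the sum of x over the fibre above (t, k) of the map b ↦ (t_b, k^i_b). The
-- occurrence lists enumerate each pair (t, k) exactly once and contain the image of every block,
-- so a sum of π_i(x) over occurrences regroups into a sum of x over blocks. This turns each
-- covering constraint of LP_cb into the corresponding one of LP_cs, and shows that
-- Σ_k y¹_{t,k} and Σ_k y²_{t,k} both equal Σ_{t_b = t} x_b. Nonnegativity of y is inherited
-- from x; and y^i_{t,k} ≤ 1 because, t being nonempty, every block counted in y^i_{t,k} covers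
-- position k of s^i, whose covering constraint sums to 1. Related strings have the same length,
-- so this constraint is available at every start position in s².
module Submission where

open import Algebra.Bundles using (CommutativeMonoid)
open import Data.Fin using (Fin)
open import Data.Fin.Properties using (_≟_)
open import Data.List
  using (List; []; _∷_; [_]; _++_; length; take; drop; filter; map; foldr; upTo)
open import Data.List.Properties
  using (filter-accept; filter-reject; filter-none; filter-all; filter-≐;
         length-take; length-drop; map-cong; map-cong-local; map-applyUpTo)
open import Data.List.Membership.Propositional using (_∈_)
open import Data.List.Membership.Propositional.Properties
  using (∈-filter⁺; ∈-filter⁻; ∈-map⁺; ∈-map⁻; ∈-upTo⁺; ∈-concatMap⁺; ∈-∃++)
open import Data.List.Relation.Binary.Infix.Heterogeneous using (Infix; here; there)
open import Data.List.Relation.Binary.Permutation.Propositional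
  using (_↭_; prep; ↭-refl; ↭-sym; ↭-trans)
open import Data.List.Relation.Binary.Permutation.Propositional.Properties
  using (↭-length; filter-↭; shift)
open import Data.List.Relation.Binary.Prefix.Heterogeneous using (Prefix; []; _∷_)
open import Data.List.Relation.Unary.All as All using (All; []; _∷_)
import Data.List.Relation.Unary.All.Properties as All
import Data.List.Relation.Unary.AllPairs as AllPairs
import Data.List.Relation.Unary.AllPairs.Properties as AllPairs
open import Data.List.Relation.Unary.Any as Any using (here; there)
open import Data.List.Relation.Unary.Unique.Propositional using (Unique)
import Data.List.Relation.Unary.Unique.Propositional.Properties as Unique
open import Data.Nat as ℕ using (ℕ; zero; suc; _∸_; _<_; _≤_; z≤n; s≤s)
import Data.Nat.Properties as ℕ
open import Data.Product using (_×_; _,_; proj₁; proj₂)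
open import Data.Rational as ℚ using (ℚ; 0ℚ; 1ℚ; _+_)
import Data.Rational.Properties as ℚ
open import Data.Unit using (tt)
open import Function using (_∘_; id)
open import Relation.Binary.PropositionalEquality
  using (_≡_; _≢_; refl; sym; trans; cong; cong₂; subst; module ≡-Reasoning)
open import Relation.Nullary using (Dec; yes; no; ¬_; contradiction)
open import Relation.Nullary.Decidable using (_×-dec_)
open import Relation.Unary using (Decidable; _⊆_)

open import Defs

open import Algebra.Properties.CommutativeSemigroup
  (CommutativeMonoid.commutativeSemigroup ℚ.+-0-commutativeMonoid) using (interchange)

-- Defs.qsum carries an unused implicit alphabet size that could not be inferred here;
-- ∑ is the same fold, so ∑ xs and qsum xs are definitionally equal.
∑ : List ℚ → ℚ
∑ = foldr _+_ 0ℚ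

_when_ : ∀ {p} {P : Set p} → ℚ → Dec P → ℚ
v when yes _ = v
v when no _  = 0ℚ

module _ {A : Set} where

  ∑-const-0 : (xs : List A) → ∑ (map (λ _ → 0ℚ) xs) ≡ 0ℚ
  ∑-const-0 []       = refl
  ∑-const-0 (_ ∷ xs) = trans (ℚ.+-identityˡ _) (∑-const-0 xs)

  ∑-map-+ : (f g : A → ℚ) (xs : List A) →
            ∑ (map (λ a → f a + g a) xs) ≡ ∑ (map f xs) + ∑ (map g xs)
  ∑-map-+ f g []       = sym (ℚ.+-identityˡ 0ℚ)
  ∑-map-+ f g (a ∷ xs) =
    trans (cong (f a + g a +_) (∑-map-+ f g xs)) (interchange (f a) (g a) _ _)

  ∑-filter : {P : A → Set} (P? : Decidable P) (f : A → ℚ) (xs : List A) →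
             ∑ (map f (filter P? xs)) ≡ ∑ (map (λ a → f a when P? a) xs)
  ∑-filter P? f []       = refl
  ∑-filter P? f (a ∷ xs) with P? a
  ... | yes _ = cong (f a +_) (∑-filter P? f xs)
  ... | no  _ = trans (∑-filter P? f xs) (sym (ℚ.+-identityˡ _))

  ∑-nonneg : {f : A → ℚ} {xs : List A} → All (λ a → 0ℚ ℚ.≤ f a) xs → 0ℚ ℚ.≤ ∑ (map f xs)
  ∑-nonneg []                          = ℚ.≤-refl
  ∑-nonneg {f} {a ∷ xs} (fa≥0 ∷ fxs≥0) =
    subst (ℚ._≤ f a + ∑ (map f xs)) (ℚ.+-identityˡ 0ℚ) (ℚ.+-mono-≤ fa≥0 (∑-nonneg fxs≥0))

  ∑-filter-mono : {P R : A → Set} (P? : Decidable P) (R? : Decidable R) → P ⊆ R →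
                  {f : A → ℚ} {xs : List A} → All (λ a → 0ℚ ℚ.≤ f a) xs →
                  ∑ (map f (filter P? xs)) ℚ.≤ ∑ (map f (filter R? xs))
  ∑-filter-mono P? R? P⊆R [] = ℚ.≤-refl
  ∑-filter-mono P? R? P⊆R {f} {a ∷ xs} (fa≥0 ∷ fxs≥0) with P? a | R? a
  ... | yes _  | yes _  = ℚ.+-monoʳ-≤ (f a) (∑-filter-mono P? R? P⊆R fxs≥0)
  ... | yes Pa | no ¬Ra = contradiction (P⊆R Pa) ¬Ra
  ... | no _   | yes _  =
    subst (ℚ._≤ _) (ℚ.+-identityˡ _) (ℚ.+-mono-≤ fa≥0 (∑-filter-mono P? R? P⊆R fxs≥0))
  ... | no _   | no _   = ∑-filter-mono P? R? P⊆R fxs≥0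

∑-swap : {A B : Set} (f : A → B → ℚ) (xs : List A) (ys : List B) →
         ∑ (map (λ a → ∑ (map (f a) ys)) xs) ≡ ∑ (map (λ b → ∑ (map (λ a → f a b) xs)) ys)
∑-swap f []       ys = sym (∑-const-0 ys)
∑-swap f (a ∷ xs) ys =
  trans (cong (∑ (map (f a) ys) +_) (∑-swap f xs ys)) (sym (∑-map-+ (f a) _ ys))

filter-unique : {A : Set} {P : A → Set} (P? : Decidable P) {a : A} {xs : List A} →
                Unique xs → a ∈ xs → P a → (∀ {b} → P b → b ≡ a) → filter P? xs ≡ [ a ]
filter-unique P? (a∉xs AllPairs.∷ _) (here refl) Pa P⇒≡a =
  trans (filter-accept P? Pa)
        (cong (_ ∷_) (filter-none P? (All.map (λ a≢b Pb → a≢b (sym (P⇒≡a Pb))) a∉xs)))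
filter-unique P? (b∉xs AllPairs.∷ xs!) (there a∈xs) Pa P⇒≡a =
  trans (filter-reject P? (λ Pb → All.lookup b∉xs a∈xs (P⇒≡a Pb)))
        (filter-unique P? xs! a∈xs Pa P⇒≡a)

-- Each b is counted in the fibre R(-, o) of at most one o ∈ O, namely o = key b.
∑-fibres : {B K : Set} (key : B → K) {R : B → K → Set} (R? : ∀ b o → Dec (R b o)) →
           (∀ {b o} → R b o → key b ≡ o) →
           {P : K → Set} (P? : Decidable P) (x : B → ℚ) (L : List B) {O : List K} →
           Unique O → (∀ {b} → b ∈ L → R b (key b) → key b ∈ O) →
           ∑ (map (λ o → ∑ (map x (filter (λ b → R? b o) L))) (filter P? O))
             ≡ ∑ (map x (filter (λ b → R? b (key b) ×-dec P? (key b)) L))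
∑-fibres key {R} R? R⇒key {P} P? x L {O} O! key∈O = begin
    ∑ (map (λ o → ∑ (map x (filter (λ b → R? b o) L))) (filter P? O))
  ≡⟨ cong ∑ (map-cong (λ o → ∑-filter (λ b → R? b o) x L) (filter P? O)) ⟩
    ∑ (map (λ o → ∑ (map (λ b → x b when R? b o) L)) (filter P? O))
  ≡⟨ ∑-swap (λ o b → x b when R? b o) (filter P? O) L ⟩
    ∑ (map (λ b → ∑ (map (λ o → x b when R? b o) (filter P? O))) L)
  ≡⟨ cong ∑ (map-cong-local (All.tabulate fibre)) ⟩
    ∑ (map (λ b → x b when (R? b (key b) ×-dec P? (key b))) L)
  ≡⟨ ∑-filter _ x L ⟨
    ∑ (map x (filter (λ b → R? b (key b) ×-dec P? (key b)) L))
  ∎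
  where
  open ≡-Reasoning

  fibre-filter : ∀ {b} → b ∈ L → ∑ (map (λ _ → x b) (filter (R? b) (filter P? O)))
                                   ≡ x b when (R? b (key b) ×-dec P? (key b))
  fibre-filter {b} b∈L with R? b (key b) ×-dec P? (key b)
  ... | yes (Rb , Pb) =
    trans (cong (∑ ∘ map (λ _ → x b))
                (filter-unique (R? b) (Unique.filter⁺ P? O!) (∈-filter⁺ P? (key∈O b∈L Rb) Pb)
                               Rb (sym ∘ R⇒key)))
          (ℚ.+-identityʳ (x b))
  ... | no ¬RPb = cong (∑ ∘ map (λ _ → x b)) (filter-none (R? b) (All.tabulate outside))
    where
    outside : ∀ {o} → o ∈ filter P? O → ¬ R b o
    outside o∈ Rbo with refl ← R⇒key Rbo = ¬RPb (Rbo , proj₂ (∈-filter⁻ P? {xs = O} o∈))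

  fibre : ∀ {b} → b ∈ L → ∑ (map (λ o → x b when R? b o) (filter P? O))
                            ≡ x b when (R? b (key b) ×-dec P? (key b))
  fibre {b} b∈L = trans (sym (∑-filter (R? b) (λ _ → x b) (filter P? O))) (fibre-filter b∈L)

module _ {A : Set} where

  length>0 : {xs : List A} → xs ≢ [] → 0 < length xs
  length>0 {[]}    []≢[] = contradiction refl []≢[]
  length>0 {_ ∷ _} _     = s≤s z≤n

  take-prefix : ∀ n (xs : List A) → Prefix _≡_ (take n xs) xs
  take-prefix zero    xs       = []
  take-prefix (suc n) []       = []
  take-prefix (suc n) (x ∷ xs) = refl ∷ take-prefix n xs

  take-drop-infix : ∀ k n (xs : List A) → Infix _≡_ (take n (drop k xs)) xs
  take-drop-infix zero    n xs       = here (take-prefix n xs)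
  take-drop-infix (suc k) n []       = here (take-prefix n [])
  take-drop-infix (suc k) n (x ∷ xs) = there (take-drop-infix k n xs)

  length-take-≤ : ∀ {n} (xs : List A) → n ≤ length xs → length (take n xs) ≡ n
  length-take-≤ {n} xs n≤ = trans (length-take n xs) (ℕ.m≤n⇒m⊓n≡m n≤)

  take-injective : ∀ {i j} (xs : List A) → i ≤ length xs → j ≤ length xs →
                   take i xs ≡ take j xs → i ≡ j
  take-injective xs i≤ j≤ eq =
    trans (sym (length-take-≤ xs i≤)) (trans (cong length eq) (length-take-≤ xs j≤))

module _ {σ : ℕ} where

  occursAt⇒substring : {t s : Str σ} {k : ℕ} → OccursAt t s k → Substring t s
  occursAt⇒substring {t} {s} {k} occ =
    subst (λ u → Substring u s) occ (take-drop-infix k (length t) s)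

  occursAt⇒length≤ : {t s : Str σ} {k : ℕ} → OccursAt t s k → length t ≤ length s ∸ k
  occursAt⇒length≤ {t} {s} {k} occ = begin
    length t                            ≡⟨ cong length occ ⟨
    length (take (length t) (drop k s)) ≡⟨ length-take (length t) (drop k s) ⟩
    length t ℕ.⊓ length (drop k s)      ≤⟨ ℕ.m⊓n≤n (length t) _ ⟩
    length (drop k s)                   ≡⟨ length-drop k s ⟩
    length s ∸ k                        ∎
    where open ℕ.≤-Reasoning

  occursAt⇒start< : {t s : Str σ} {k : ℕ} → t ≢ [] → OccursAt t s k → k < length s
  occursAt⇒start< {s = s} {k} t≢[] occ =
    ℕ.m∸n≢0⇒n<m (ℕ.n>0⇒n≢0 (ℕ.<-≤-trans (length>0 t≢[]) (occursAt⇒length≤ {s = s} {k} occ)))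

  isBlock⇒inT : {s₁ s₂ : Str σ} {b : Block} → IsBlock s₁ s₂ b → InT s₁ s₂ (str b)
  isBlock⇒inT {b = _ , k₁ , k₂} (t≢[] , occ₁ , occ₂) =
    t≢[] , occursAt⇒substring {k = k₁} occ₁ , occursAt⇒substring {k = k₂} occ₂

  ∈blocks⇒isBlock : (s₁ s₂ : Str σ) {b : Block} → b ∈ blocks s₁ s₂ → IsBlock s₁ s₂ b
  ∈blocks⇒isBlock s₁ s₂ = proj₂ ∘ ∈-filter⁻ (isBlock? s₁ s₂) {xs = candidates s₁ s₂}

  occurrencesAt : Str σ → ℕ → List (Str σ × ℕ)
  occurrencesAt s k = map (λ ℓ → (take ℓ (drop k s) , k)) (upTo (suc (length s ∸ k)))

  ∈-occurrencesAt : {t s : Str σ} {k : ℕ} → OccursAt t s k → (t , k) ∈ occurrencesAt s k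
  ∈-occurrencesAt {t} {s} {k} occ =
    subst (λ u → (u , k) ∈ occurrencesAt s k) occ
      (∈-map⁺ (λ ℓ → (take ℓ (drop k s) , k))
              (∈-upTo⁺ (s≤s (occursAt⇒length≤ {s = s} {k} occ))))

  occurrencesAt-start : {s : Str σ} {k : ℕ} {p : Str σ × ℕ} →
                        p ∈ occurrencesAt s k → proj₂ p ≡ k
  occurrencesAt-start {s} {k} p∈
    with _ , _ , refl ← ∈-map⁻ (λ ℓ → (take ℓ (drop k s) , k))
                               {xs = upTo (suc (length s ∸ k))} p∈ = refl

  occurrencesAt-unique : (s : Str σ) (k : ℕ) → Unique (occurrencesAt s k)
  occurrencesAt-unique s k =
    subst Unique (sym (map-applyUpTo id _ _)) (Unique.applyUpTo⁺₁ _ _ distinct)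
    where
    distinct : ∀ {i j} → i < j → j < suc (length s ∸ k) →
               (take i (drop k s) , k) ≢ (take j (drop k s) , k)
    distinct {i} {j} i<j j<1+n eq =
      ℕ.<-irrefl (take-injective (drop k s) (bound (ℕ.<⇒≤ i<j)) (bound ℕ.≤-refl) (cong proj₁ eq))
                 i<j
      where
      bound : ∀ {n} → n ≤ j → n ≤ length (drop k s)
      bound n≤j = subst (_ ≤_) (sym (length-drop k s)) (ℕ.≤-trans n≤j (ℕ.≤-pred j<1+n))

  ∈-occurrences : {s₁ s₂ s t : Str σ} {k : ℕ} → InT s₁ s₂ t → OccursAt t s k →
                  (t , k) ∈ occurrences s₁ s₂ s
  ∈-occurrences {s₁} {s₂} {s} t∈T occ =
    ∈-filter⁺ (inT? s₁ s₂ ∘ proj₁)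
      (∈-concatMap⁺ (occurrencesAt s)
        (Any.map (λ { refl → ∈-occurrencesAt occ }) (∈-upTo⁺ (occursAt⇒start< (proj₁ t∈T) occ))))
      t∈T

  occurrences-unique : (s₁ s₂ s : Str σ) → Unique (occurrences s₁ s₂ s)
  occurrences-unique s₁ s₂ s =
    Unique.filter⁺ (inT? s₁ s₂ ∘ proj₁)
      (Unique.concat⁺ (All.map⁺ (All.universal (occurrencesAt-unique s) _))
        (AllPairs.map⁺ (AllPairs.map disjoint (Unique.upTo⁺ (length s)))))
    where
    disjoint : ∀ {k k′} → k ≢ k′ → ∀ {p} → ¬ (p ∈ occurrencesAt s k × p ∈ occurrencesAt s k′)
    disjoint k≢k′ (p∈ , p∈′) =
      k≢k′ (trans (sym (occurrencesAt-start p∈)) (occurrencesAt-start p∈′))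

  ∈-Q : {t s : Str σ} {k : ℕ} → t ≢ [] → OccursAt t s k → k ∈ Q t s
  ∈-Q {t} {s} t≢[] occ = ∈-filter⁺ (occursAt? t s) (∈-upTo⁺ (occursAt⇒start< t≢[] occ)) occ

  Q-unique : (t s : Str σ) → Unique (Q t s)
  Q-unique t s = Unique.filter⁺ (occursAt? t s) (Unique.upTo⁺ (length s))

  count-head>0 : (c : Fin σ) (s : Str σ) → 0 < count c (c ∷ s)
  count-head>0 c s rewrite filter-accept (c ≟_) {xs = s} refl = s≤s z≤n

  count>0⇒∈ : {c : Fin σ} (s : Str σ) → 0 < count c s → c ∈ s
  count>0⇒∈      []      ()
  count>0⇒∈ {c} (d ∷ s) c∈s with c ≟ d
  ... | yes refl = here refl
  ... | no _     = there (count>0⇒∈ s c∈s)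

  count-∷-cancel : {a c : Fin σ} (u v : Str σ) →
                   count a (c ∷ u) ≡ count a (c ∷ v) → count a u ≡ count a v
  count-∷-cancel {a} {c} u v eq with a ≟ c
  ... | yes _ = ℕ.suc-injective eq
  ... | no  _ = eq

  count-resp-↭ : (a : Fin σ) {u v : Str σ} → u ↭ v → count a u ≡ count a v
  count-resp-↭ a u↭v = ↭-length (filter-↭ (a ≟_) u↭v)

  related⇒↭ : (s₁ s₂ : Str σ) → Related s₁ s₂ → s₁ ↭ s₂
  related⇒↭ []      []      _   = ↭-refl
  related⇒↭ []      (c ∷ s) rel =
    contradiction (subst (0 <_) (sym (rel c)) (count-head>0 c s)) (ℕ.<-irrefl refl)
  related⇒↭ (c ∷ r) s       rel
    with ∈-∃++ (count>0⇒∈ s (subst (0 <_) (rel c) (count-head>0 c r)))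
  ... | ys , zs , refl = ↭-trans (prep c (related⇒↭ r (ys ++ zs) rel′)) (↭-sym (shift c ys zs))
    where
    rel′ : Related r (ys ++ zs)
    rel′ a = count-∷-cancel r (ys ++ zs) (trans (rel a) (count-resp-↭ a (shift c ys zs)))

  related⇒length≡ : {s₁ s₂ : Str σ} → Related s₁ s₂ → length s₁ ≡ length s₂
  related⇒length≡ {s₁} {s₂} rel = ↭-length (related⇒↭ s₁ s₂ rel)

-- Side i of the projection, for i = 1, 2: pos = k^i, s = s^i and y = π_i(x).
module Side {σ : ℕ} {s₁ s₂ : Str σ} {x : Block → ℚ}
  (x≥0 : ∀ {b} → IsBlock s₁ s₂ b → 0ℚ ℚ.≤ x b)
  (pos : Block → ℕ) (s : Str σ)
  (occurs : ∀ {b} → IsBlock s₁ s₂ b → OccursAt (str b) s (pos b))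
  (cover : ∀ j → j < length s₁ →
           ∑ (map x (filter (λ b → covers? (pos b) (str b) j) (blocks s₁ s₂))) ≡ 1ℚ)
  where

  B : List Block
  B = blocks s₁ s₂

  y : Str σ → ℕ → ℚ
  y t k = ∑ (map x (filter (λ b → (str b ≟s t) ×-dec (pos b ℕ.≟ k)) B))

  x≥0-on-B : All (λ b → 0ℚ ℚ.≤ x b) B
  x≥0-on-B = All.tabulate (x≥0 ∘ ∈blocks⇒isBlock s₁ s₂)

  y-cover : ∀ j → j < length s₁ →
            ∑ (map (λ p → y (proj₁ p) (proj₂ p))
                   (filter (λ p → covers? (proj₂ p) (proj₁ p) j) (occurrences s₁ s₂ s))) ≡ 1ℚ
  y-cover j j<n = begin
      ∑ (map (λ p → y (proj₁ p) (proj₂ p))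
             (filter (λ p → covers? (proj₂ p) (proj₁ p) j) (occurrences s₁ s₂ s)))
    ≡⟨ ∑-fibres key R? (λ (t≡ , k≡) → cong₂ _,_ t≡ k≡) (λ p → covers? (proj₂ p) (proj₁ p) j)
                x B (occurrences-unique s₁ s₂ s) key∈occurrences ⟩
      ∑ (map x (filter (λ b → R? b (key b) ×-dec covers? (pos b) (str b) j) B))
    ≡⟨ cong (∑ ∘ map x) (filter-≐ _ _ (proj₂ , ((refl , refl) ,_)) B) ⟩
      ∑ (map x (filter (λ b → covers? (pos b) (str b) j) B))
    ≡⟨ cover j j<n ⟩
      1ℚ
    ∎
    where
    open ≡-Reasoning
    key : Block → Str σ × ℕ
    key b = str b , pos b
    R? : (b : Block) (p : Str σ × ℕ) → Dec ((str b ≡ proj₁ p) × (pos b ≡ proj₂ p))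
    R? b p = (str b ≟s proj₁ p) ×-dec (pos b ℕ.≟ proj₂ p)
    key∈occurrences : ∀ {b} → b ∈ B → (str b ≡ str b) × (pos b ≡ pos b) →
                      key b ∈ occurrences s₁ s₂ s
    key∈occurrences {b} b∈B _ = ∈-occurrences (isBlock⇒inT {b = b} b-isBlock) (occurs b-isBlock)
      where
      b-isBlock : IsBlock s₁ s₂ b
      b-isBlock = ∈blocks⇒isBlock s₁ s₂ b∈B

  y-total : ∀ t → ∑ (map (y t) (Q t s)) ≡ ∑ (map x (filter (λ b → str b ≟s t) B))
  y-total t = begin
      ∑ (map (y t) (Q t s))
    ≡⟨ cong (∑ ∘ map (y t)) (filter-all (λ _ → yes tt) (All.universal _ (Q t s))) ⟨
      ∑ (map (y t) (filter (λ _ → yes tt) (Q t s)))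
    ≡⟨ ∑-fibres pos R? proj₂ (λ _ → yes tt) x B (Q-unique t s) pos∈Q ⟩
      ∑ (map x (filter (λ b → R? b (pos b) ×-dec yes tt) B))
    ≡⟨ cong (∑ ∘ map x) (filter-≐ _ _ (proj₁ ∘ proj₁ , λ t≡ → (t≡ , refl) , tt) B) ⟩
      ∑ (map x (filter (λ b → str b ≟s t) B))
    ∎
    where
    open ≡-Reasoning
    R? : (b : Block) (k : ℕ) → Dec ((str b ≡ t) × (pos b ≡ k))
    R? b k = (str b ≟s t) ×-dec (pos b ℕ.≟ k)
    pos∈Q : ∀ {b} → b ∈ B → (str b ≡ t) × (pos b ≡ pos b) → pos b ∈ Q t s
    pos∈Q {b} b∈B (refl , _) = ∈-Q (proj₁ b-isBlock) (occurs b-isBlock)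
      where
      b-isBlock : IsBlock s₁ s₂ b
      b-isBlock = ∈blocks⇒isBlock s₁ s₂ b∈B

  y≥0 : ∀ t k → 0ℚ ℚ.≤ y t k
  y≥0 t k = ∑-nonneg (All.filter⁺ _ x≥0-on-B)

  y≤1 : ∀ {t} → t ≢ [] → ∀ k → k < length s₁ → y t k ℚ.≤ 1ℚ
  y≤1 {t} t≢[] k k<n =
    ℚ.≤-trans (∑-filter-mono _ _ covers-start x≥0-on-B) (ℚ.≤-reflexive (cover k k<n))
    where
    covers-start : ∀ {b} → (str b ≡ t) × (pos b ≡ k) → Covers (pos b) (str b) k
    covers-start {b} (refl , refl) = ℕ.≤-refl , ℕ.m<m+n (pos b) (length>0 t≢[])

lemma1 : (σ : ℕ) (s₁ s₂ : Str σ) (x : Block → ℚ) →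
         Related s₁ s₂ →
         FeasibleCB s₁ s₂ x →
         FeasibleCS s₁ s₂ (π₁ s₁ s₂ x) (π₂ s₁ s₂ x)
lemma1 σ s₁ s₂ x related (cover₁ , cover₂ , x-bounds) =
    S₁.y-cover , S₂.y-cover
  , (λ t _ → trans (S₁.y-total t) (sym (S₂.y-total t)))
  , (λ t (t≢[] , _) k occ → S₁.y≥0 t k , S₁.y≤1 t≢[] k (occursAt⇒start< t≢[] occ))
  , (λ t (t≢[] , _) k occ → S₂.y≥0 t k , S₂.y≤1 t≢[] k
       (subst (k <_) (sym (related⇒length≡ {s₁ = s₁} {s₂} related)) (occursAt⇒start< t≢[] occ)))
  where
  x≥0 : ∀ {b} → IsBlock s₁ s₂ b → 0ℚ ℚ.≤ x b
  x≥0 = proj₁ ∘ x-bounds _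
  module S₁ = Side {s₁ = s₁} {s₂} {x} x≥0 pos₁ s₁ (proj₁ ∘ proj₂) cover₁
  module S₂ = Side {s₁ = s₁} {s₂} {x} x≥0 pos₂ s₂ (proj₂ ∘ proj₂) cover₂
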